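{- Let $G=(V,E)$ be an undirected weighted graph, $T\subseteq V$ a terminal set, $S\subseteq T$ with $|S|\ge 2|T|/3$, and $s,\delta,\gamma>0$. Suppose $V$ is $(s,\delta,\gamma,S)$-terminal-strong in $G$. Let $\kappa=\min\{\gamma/(2s),\gamma/6\}$. Let $G'$ be obtained from $G$ by adding a source $\sigma$ with an edge of capacity $\delta\kappa$ to each terminal in $S$ and a sink $\tau$ with an edge of capacity $\delta\kappa$ from each terminal in $T\setminus S$; let $(U',\overline{U'})$ be a minimum $\sigma$–$\tau$ cut in $G'$ with $\sigma\in U'$, and set $U=U'\setminus\{\sigma\}$, $\overline U=\overline{U'}\setminus\{\tau\}$. Then $|U\cap T|\ge|T|/3$ and $U$ is $(\max\{2/\kappa+s,3s\},\ \delta,\ \kappa,\ U\cap T)$-terminal-strong in $G$.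
   Context: For $X\subseteq V$, $\partial X$ is the set of edges with exactly one endpoint in $X$, $\overline X=V\setminus X$, and $\partial_{G[U]}C$ is the set of edges with both endpoints in $U$ and exactly one endpoint in $C$. A Steiner cut is a cut $(C,\overline C)$ such that both sides contain a vertex of $T$. For $X\subseteq T$, a set $U\subseteq V$ is $(s,\delta,\gamma,X)$-terminal-strong in $G$ if every Steiner cut $(C,\overline C)$ of $G$ with $w(\partial C)\le\delta$ satisfies $\min\{|C\cap U\cap X|,|\overline C\cap U\cap X|\}\le s$, and moreover, if $|C\cap U\cap X|>0$ and $|\overline C\cap U\cap X|>0$, then $w(\partial_{G[U]}C)\ge\gamma\cdot\delta$.
   Formalization: The edge weights of G and the parameters s, δ, γ are rational numbers, so the capacities δκ of the new edges of G′ are rational as well. -}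

module Defs where

open import Data.Nat as ℕ using (ℕ; zero; suc)
open import Data.Integer using (+_)
open import Data.Rational using (ℚ; 0ℚ; _+_; _*_; _÷_; _/_; _≤_; _<_; _⊓_; _⊔_; Positive; positive; NonZero)
open import Data.Rational.Properties using (pos⇒nonZero; pos*pos⇒pos; 1/pos⇒pos; ⊓-sel)
open import Data.Fin using (Fin; zero; suc)
open import Data.Fin.Subset using (Subset; _∩_; ∁; ∣_∣; Nonempty)
open import Data.Vec using (lookup)
open import Data.Bool using (Bool; true; false; if_then_else_; _∧_; not)
open import Data.Product using (_×_)
open import Data.Sum using (inj₁; inj₂)
open import Relation.Binary.PropositionalEquality using (_≡_; subst)

ℕ→ℚ : ℕ → ℚ
ℕ→ℚ n = + n / 1

sumFin : ∀ {n} → (Fin n → ℚ) → ℚ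
sumFin {zero}  f = 0ℚ
sumFin {suc n} f = f zero + sumFin (λ i → f (suc i))

-- an undirected weighted graph on vertex set Fin n, given by a symmetric
-- nonnegative weight function (weight 0 = no edge), no self loops
record WGraph (n : ℕ) : Set where
  field
    w       : Fin n → Fin n → ℚ
    w-sym   : ∀ i j → w i j ≡ w j i
    w-nonneg : ∀ i j → 0ℚ ≤ w i j
    w-loop  : ∀ i → w i i ≡ 0ℚ
open WGraph public

between : ∀ {n} → (Fin n → Fin n → ℚ) → Subset n → Subset n → ℚ
between w A B = sumFin (λ i → sumFin (λ j →
  if lookup A i ∧ lookup B j then w i j else 0ℚ))

cutWeight : ∀ {n} → (Fin n → Fin n → ℚ) → Subset n → ℚ
cutWeight w C = between w C (∁ C)

inducedCutWeight : ∀ {n} → (Fin n → Fin n → ℚ) → Subset n → Subset n → ℚ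
inducedCutWeight w U C = between w (C ∩ U) (∁ C ∩ U)

SteinerCut : ∀ {n} → Subset n → Subset n → Set
SteinerCut T C = Nonempty (C ∩ T) × Nonempty (∁ C ∩ T)

TerminalStrong : ∀ {n} → WGraph n → (T : Subset n) →
                 (s δ γ : ℚ) → (X U : Subset n) → Set
TerminalStrong G T s δ γ X U =
  ∀ C → SteinerCut T C → cutWeight (w G) C ≤ δ →
    (ℕ→ℚ (∣ C ∩ U ∩ X ∣ ℕ.⊓ ∣ ∁ C ∩ U ∩ X ∣) ≤ s)
    × (0 ℕ.< ∣ C ∩ U ∩ X ∣ → 0 ℕ.< ∣ ∁ C ∩ U ∩ X ∣ →
         γ * δ ≤ inducedCutWeight (w G) U C)

private
  pos2s : ∀ s → 0ℚ < s → Positive (ℕ→ℚ 2 * s)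
  pos2s s hs = pos*pos⇒pos (ℕ→ℚ 2) s {{positive hs}}

kappa : (s γ : ℚ) → 0ℚ < s → ℚ
kappa s γ hs =
  (_÷_ γ (ℕ→ℚ 2 * s) {{pos⇒nonZero (ℕ→ℚ 2 * s) {{pos2s s hs}}}}) ⊓ (γ ÷ ℕ→ℚ 6)

kappa-pos : (s γ : ℚ) (hs : 0ℚ < s) → 0ℚ < γ → Positive (kappa s γ hs)
kappa-pos s γ hs hγ with ⊓-sel a b
  where
  a = _÷_ γ (ℕ→ℚ 2 * s) {{pos⇒nonZero (ℕ→ℚ 2 * s) {{pos2s s hs}}}}
  b = γ ÷ ℕ→ℚ 6
... | inj₁ e = subst Positive (Relation.Binary.PropositionalEquality.sym e)
    (pos*pos⇒pos γ {{positive hγ}} _ {{1/pos⇒pos (ℕ→ℚ 2 * s) {{pos2s s hs}}}})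
... | inj₂ e = subst Positive (Relation.Binary.PropositionalEquality.sym e)
    (pos*pos⇒pos γ {{positive hγ}} _ {{1/pos⇒pos (ℕ→ℚ 6)}})

twoOverKappa : (s γ : ℚ) (hs : 0ℚ < s) → 0ℚ < γ → ℚ
twoOverKappa s γ hs hγ =
  _÷_ (ℕ→ℚ 2) (kappa s γ hs) {{pos⇒nonZero (kappa s γ hs) {{kappa-pos s γ hs hγ}}}}

-- The auxiliary graph G' on Fin (2 + n): σ = zero, τ = suc zero,
-- original vertex i becomes suc (suc i).  c = δκ is the capacity of the new edges.
augW : ∀ {n} → (Fin n → Fin n → ℚ) → (T S : Subset n) → (c : ℚ) →
       Fin (suc (suc n)) → Fin (suc (suc n)) → ℚ
augW w T S c zero zero = 0ℚ
augW w T S c zero (suc zero) = 0ℚ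
augW w T S c (suc zero) zero = 0ℚ
augW w T S c (suc zero) (suc zero) = 0ℚ
augW w T S c zero (suc (suc j)) = if lookup S j then c else 0ℚ
augW w T S c (suc (suc i)) zero = if lookup S i then c else 0ℚ
augW w T S c (suc zero) (suc (suc j)) = if lookup T j ∧ not (lookup S j) then c else 0ℚ
augW w T S c (suc (suc i)) (suc zero) = if lookup T i ∧ not (lookup S i) then c else 0ℚ
augW w T S c (suc (suc i)) (suc (suc j)) = w i j

σ τ : ∀ {n} → Fin (suc (suc n))
σ = zero
τ = suc zero

IsSTCut : ∀ {n} → Subset (suc (suc n)) → Set
IsSTCut U' = (lookup U' σ ≡ true) × (lookup U' τ ≡ false)

IsMinSTCut : ∀ {n} → (Fin (suc (suc n)) → Fin (suc (suc n)) → ℚ) →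
             Subset (suc (suc n)) → Set
IsMinSTCut w' U' = IsSTCut U' × (∀ X → IsSTCut X → cutWeight w' U' ≤ cutWeight w' X)

module Submission where

-- Write c = δκ. The σ–τ cut of G′ with source side {σ} ∪ Y costs w(∂Y) + c·|S ∖ Y| + c·|Y ∩ (T ∖ S)|,
-- and U minimises this. Comparing U with V gives |S ∖ U| ≤ |T ∖ S|, hence |U ∩ T| ≥ |T|/3 when
-- |S| ≥ 2|T|/3. Comparing U with U ∖ X for X ⊆ U gives the exchange inequality
--   w(X, V ∖ U) + c·|X ∩ (T ∖ S)| ≤ w(U ∖ X, X) + c·|X ∩ S|.
-- Let C be a Steiner cut with w(∂C) ≤ δ; replacing C by its complement, strongness of V lets us assume
-- |C ∩ S| ≤ s. For X = C ∩ U the right-hand side is then at most δ + s·c, so |X ∩ T| ≤ s + (1/κ + s).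
-- Suppose both C ∩ U and U ∖ C contain terminals. If one of them contains no terminal of S, the exchange
-- inequality for it gives w(C ∩ U, U ∖ C) ≥ c. Otherwise w(C ∩ U, U ∖ C) < c would give
-- w(∂(C ∩ U)) < (2 + s)·c ≤ γδ (as κ ≤ γ/6 and sκ ≤ γ/2), although C ∩ U separates terminals of S,
-- contradicting the strongness of V.

open import Defs
open import Data.Nat as ℕ using (ℕ; zero; suc)
open import Data.Rational using (ℚ; 0ℚ; _+_; _*_; _≤_; _<_; _⊔_)
open import Data.Fin.Subset using (Subset; _∩_; ∣_∣; _⊆_; ⊤)
open import Data.Product using (_×_; _,_; proj₁; proj₂)
open import Data.Vec using (tail)

open import Data.Rational.Properties
import Algebra.Bundles
open import Algebra.Properties.CommutativeMonoid.Sum +-0-commutativeMonoid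
  using (sum; sum-cong-≗; sum-replicate-zero; ∑-comm)
open import Algebra.Properties.CommutativeSemigroup
  (Algebra.Bundles.CommutativeMonoid.commutativeSemigroup +-0-commutativeMonoid) using (interchange)
open import Data.Bool using (true; false; if_then_else_; _∧_; not)
open import Data.Bool.Properties using (∧-comm; not-involutive)
open import Data.Fin using (Fin; zero; suc)
open import Data.Fin.Subset using (inside; outside; ∁; ⊥; Nonempty)
open import Data.Fin.Subset.Properties
  using (drop-∷-⊆; ∩-identityˡ; ∩-identityʳ; ∩-zeroˡ; ∩-assoc; ∩-idem; ∣⊥∣≡0;
         x∈p∩q⁺; x∈p∩q⁻; p∩q⊆p; x∈∁p⇒x∉p; x∉p⇒x∈∁p; p⊆q⇒∣p∣≤∣q∣)
import Data.Integer as ℤ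
import Data.Integer.Properties as ℤ
open import Data.Integer.Tactic.RingSolver renaming (solve-∀ to ℤ-solve-∀)
open import Data.Maybe using (nothing)
import Data.Nat.Coprimality as Coprime
import Data.Nat.Properties as ℕ
import Data.Nat.Tactic.RingSolver as ℕ-Solver
import Data.Rational
open import Data.Rational using (1ℚ; mkℚ; toℚᵘ; -_; nonNegative; positive; Positive; _÷_; 1/_)
import Data.Rational.Unnormalised as ℚᵘ
import Data.Rational.Unnormalised.Properties as ℚᵘ
open import Data.Sum using (inj₁; inj₂; [_,_]′)
open import Data.Vec using ([]; _∷_; lookup; here; there)
open import Data.Vec.Properties using (lookup-zipWith; lookup-map)
open import Function using (_∘_)
open import Relation.Binary.PropositionalEquality
open import Relation.Nullary using (Dec; yes; no; contradiction)
open import Tactic.RingSolver using (solve-∀)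
open import Tactic.RingSolver.Core.AlmostCommutativeRing using (AlmostCommutativeRing; fromCommutativeRing)

private
  variable
    n : ℕ
    p q r : Subset n
    f g : Fin n → ℚ

-- The zero test passed to the solver is only an optimisation, so none is needed.
ℚ-ring : AlmostCommutativeRing _ _
ℚ-ring = fromCommutativeRing +-*-commutativeRing (λ _ → nothing)

x≤x+y : ∀ {x y} → 0ℚ ≤ y → x ≤ x + y
x≤x+y {x} {y} 0≤y = subst (_≤ x + y) (+-identityʳ x) (+-monoʳ-≤ x 0≤y)

x≤y+x : ∀ {x y} → 0ℚ ≤ y → x ≤ y + x
x≤y+x {x} {y} 0≤y = subst (x ≤_) (+-comm x y) (x≤x+y 0≤y)

+-cancelʳ-≤ : ∀ z {x y} → x + z ≤ y + z → x ≤ y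
+-cancelʳ-≤ z {x} {y} le = subst₂ _≤_ (cancel x) (cancel y) (+-monoˡ-≤ (- z) le)
  where
  cancel : ∀ a → a + z + - z ≡ a
  cancel a = trans (+-assoc a z (- z)) (trans (cong (a +_) (+-inverseʳ z)) (+-identityʳ a))

toℚᵘ-ℕ→ℚ : ∀ n → toℚᵘ (ℕ→ℚ n) ≡ ℚᵘ.mkℚᵘ (ℤ.+ n) 0
toℚᵘ-ℕ→ℚ n = cong toℚᵘ (↥p/↧p≡p (mkℚ (ℤ.+ n) 0 (Coprime.sym (Coprime.1-coprimeTo n))))

ℕ→ℚ-+ : ∀ m n → ℕ→ℚ (m ℕ.+ n) ≡ ℕ→ℚ m + ℕ→ℚ n
ℕ→ℚ-+ m n = toℚᵘ-injective (begin
  toℚᵘ (ℕ→ℚ (m ℕ.+ n))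
    ≡⟨ toℚᵘ-ℕ→ℚ (m ℕ.+ n) ⟩
  ℚᵘ.mkℚᵘ (ℤ.+ (m ℕ.+ n)) 0
    ≈⟨ ℚᵘ.*≡* (trans (cong (ℤ._* ℤ.1ℤ) (ℤ.pos-+ m n)) (ℤ-lemma (ℤ.+ m) (ℤ.+ n))) ⟩
  ℚᵘ.mkℚᵘ (ℤ.+ m) 0 ℚᵘ.+ ℚᵘ.mkℚᵘ (ℤ.+ n) 0
    ≡⟨ cong₂ ℚᵘ._+_ (toℚᵘ-ℕ→ℚ m) (toℚᵘ-ℕ→ℚ n) ⟨
  toℚᵘ (ℕ→ℚ m) ℚᵘ.+ toℚᵘ (ℕ→ℚ n)
    ≈⟨ ℚᵘ.≃-sym (toℚᵘ-homo-+ (ℕ→ℚ m) (ℕ→ℚ n)) ⟩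
  toℚᵘ (ℕ→ℚ m + ℕ→ℚ n) ∎)
  where
  open import Relation.Binary.Reasoning.Setoid ℚᵘ.≃-setoid
  ℤ-lemma : ∀ a b → (a ℤ.+ b) ℤ.* ℤ.1ℤ ≡ (a ℤ.* ℤ.1ℤ ℤ.+ b ℤ.* ℤ.1ℤ) ℤ.* ℤ.1ℤ
  ℤ-lemma = ℤ-solve-∀

ℕ→ℚ-mono-≤ : ∀ {m n} → m ℕ.≤ n → ℕ→ℚ m ≤ ℕ→ℚ n
ℕ→ℚ-mono-≤ {m} {n} m≤n = toℚᵘ-cancel-≤ (subst₂ ℚᵘ._≤_ (sym (toℚᵘ-ℕ→ℚ m)) (sym (toℚᵘ-ℕ→ℚ n))
  (ℚᵘ.*≤* (ℤ.*-monoʳ-≤-nonNeg ℤ.1ℤ (ℤ.+≤+ m≤n))))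

ℕ→ℚ-cancel-≤ : ∀ {m n} → ℕ→ℚ m ≤ ℕ→ℚ n → m ℕ.≤ n
ℕ→ℚ-cancel-≤ {m} {n} h = ℤ.drop‿+≤+ (subst₂ ℤ._≤_ (ℤ.*-identityʳ _) (ℤ.*-identityʳ _)
  (ℚᵘ.drop-*≤* (subst₂ ℚᵘ._≤_ (toℚᵘ-ℕ→ℚ m) (toℚᵘ-ℕ→ℚ n) (toℚᵘ-mono-≤ h))))

∁⊤≡⊥ : ∀ n → ∁ (⊤ {n}) ≡ ⊥
∁⊤≡⊥ zero    = refl
∁⊤≡⊥ (suc n) = cong (outside ∷_) (∁⊤≡⊥ n)

∩-monoʳ-⊆ : ∀ p → q ⊆ r → p ∩ q ⊆ p ∩ r
∩-monoʳ-⊆ {q = q} p q⊆r x∈p∩q = let x∈p , x∈q = x∈p∩q⁻ p q x∈p∩q in x∈p∩q⁺ (x∈p , q⊆r x∈q)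

∩-monoˡ-⊆ : ∀ r → p ⊆ q → p ∩ r ⊆ q ∩ r
∩-monoˡ-⊆ {p = p} r p⊆q x∈p∩r = let x∈p , x∈r = x∈p∩q⁻ p r x∈p∩r in x∈p∩q⁺ (p⊆q x∈p , x∈r)

∁-involutive : ∀ (p : Subset n) → ∁ (∁ p) ≡ p
∁-involutive []      = refl
∁-involutive (b ∷ p) = cong₂ _∷_ (not-involutive b) (∁-involutive p)

∣p∣>0⇒nonempty : ∀ (p : Subset n) → 0 ℕ.< ∣ p ∣ → Nonempty p
∣p∣>0⇒nonempty (inside  ∷ p) _ = zero , here
∣p∣>0⇒nonempty (outside ∷ p) h = let i , i∈p = ∣p∣>0⇒nonempty p h in suc i , there i∈p

∁∩⊆∁∩ : ∀ (p q : Subset n) → ∁ p ∩ q ⊆ ∁ (p ∩ q)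
∁∩⊆∁∩ p q x∈∁p∩q = x∉p⇒x∈∁p (x∈∁p⇒x∉p (proj₁ (x∈p∩q⁻ (∁ p) q x∈∁p∩q)) ∘ p∩q⊆p p q)

∩-∩-absorb : ∀ (p q r : Subset n) → p ∩ q ∩ (q ∩ r) ≡ (p ∩ q) ∩ r
∩-∩-absorb p q r = begin
  p ∩ (q ∩ (q ∩ r))     ≡⟨ cong (p ∩_) (∩-assoc q q r) ⟨
  p ∩ ((q ∩ q) ∩ r)     ≡⟨ cong (λ x → p ∩ (x ∩ r)) (∩-idem q) ⟩
  p ∩ (q ∩ r)           ≡⟨ ∩-assoc p q r ⟨
  (p ∩ q) ∩ r ∎
  where open ≡-Reasoning

-- Partitions of subsets

data Partition : Subset n → Subset n → Subset n → Set where
  []  : Partition [] [] []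
  inˡ : Partition p q r → Partition (inside ∷ p) (inside ∷ q) (outside ∷ r)
  inʳ : Partition p q r → Partition (inside ∷ p) (outside ∷ q) (inside ∷ r)
  out : Partition p q r → Partition (outside ∷ p) (outside ∷ q) (outside ∷ r)

∣∣-partition : Partition p q r → ∣ p ∣ ≡ ∣ q ∣ ℕ.+ ∣ r ∣
∣∣-partition []                      = refl
∣∣-partition (inˡ h)                 = cong suc (∣∣-partition h)
∣∣-partition (inʳ {q = q} {r} h)     = trans (cong suc (∣∣-partition h)) (sym (ℕ.+-suc ∣ q ∣ ∣ r ∣))
∣∣-partition (out h)                 = ∣∣-partition h

Partition-swap : Partition p q r → Partition p r q
Partition-swap []      = []
Partition-swap (inˡ h) = inʳ (Partition-swap h)
Partition-swap (inʳ h) = inˡ (Partition-swap h)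
Partition-swap (out h) = out (Partition-swap h)

Partition-∁ : Partition p q r → Partition (∁ r) (∁ p) q
Partition-∁ []      = []
Partition-∁ (inˡ h) = inʳ (Partition-∁ h)
Partition-∁ (inʳ h) = out (Partition-∁ h)
Partition-∁ (out h) = inˡ (Partition-∁ h)

Partition-∩ʳ : Partition p q r → ∀ t → Partition (p ∩ t) (q ∩ t) (r ∩ t)
Partition-∩ʳ []      []            = []
Partition-∩ʳ (inˡ h) (inside  ∷ t) = inˡ (Partition-∩ʳ h t)
Partition-∩ʳ (inˡ h) (outside ∷ t) = out (Partition-∩ʳ h t)
Partition-∩ʳ (inʳ h) (inside  ∷ t) = inʳ (Partition-∩ʳ h t)
Partition-∩ʳ (inʳ h) (outside ∷ t) = out (Partition-∩ʳ h t)
Partition-∩ʳ (out h) (_       ∷ t) = out (Partition-∩ʳ h t)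

Partition-∩ˡ : Partition p q r → ∀ t → Partition (t ∩ p) (t ∩ q) (t ∩ r)
Partition-∩ˡ []      []            = []
Partition-∩ˡ (inˡ h) (inside  ∷ t) = inˡ (Partition-∩ˡ h t)
Partition-∩ˡ (inʳ h) (inside  ∷ t) = inʳ (Partition-∩ˡ h t)
Partition-∩ˡ (out h) (inside  ∷ t) = out (Partition-∩ˡ h t)
Partition-∩ˡ (inˡ h) (outside ∷ t) = out (Partition-∩ˡ h t)
Partition-∩ˡ (inʳ h) (outside ∷ t) = out (Partition-∩ˡ h t)
Partition-∩ˡ (out h) (outside ∷ t) = out (Partition-∩ˡ h t)

∩-∁-partition : ∀ (p q : Subset n) → Partition q (p ∩ q) (∁ p ∩ q)
∩-∁-partition []            []            = []
∩-∁-partition (inside  ∷ p) (inside  ∷ q) = inˡ (∩-∁-partition p q)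
∩-∁-partition (outside ∷ p) (inside  ∷ q) = inʳ (∩-∁-partition p q)
∩-∁-partition (inside  ∷ p) (outside ∷ q) = out (∩-∁-partition p q)
∩-∁-partition (outside ∷ p) (outside ∷ q) = out (∩-∁-partition p q)

⊆⇒partition : q ⊆ p → Partition p q (p ∩ ∁ q)
⊆⇒partition {q = []}           {[]}           _   = []
⊆⇒partition {q = inside  ∷ q}  {inside  ∷ p}  q⊆p = inˡ (⊆⇒partition (drop-∷-⊆ q⊆p))
⊆⇒partition {q = outside ∷ q}  {inside  ∷ p}  q⊆p = inʳ (⊆⇒partition (drop-∷-⊆ q⊆p))
⊆⇒partition {q = outside ∷ q}  {outside ∷ p}  q⊆p = out (⊆⇒partition (drop-∷-⊆ q⊆p))
⊆⇒partition {q = inside  ∷ q}  {outside ∷ p}  q⊆p with q⊆p here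
... | ()

sumOver : Subset n → (Fin n → ℚ) → ℚ
sumOver []      f = 0ℚ
sumOver (b ∷ p) f = (if b then f zero else 0ℚ) + sumOver p (f ∘ suc)

sumOver-partition : Partition p q r → ∀ f → sumOver p f ≡ sumOver q f + sumOver r f
sumOver-partition []      f = sym (+-identityʳ 0ℚ)
sumOver-partition (inˡ {q = q} {r} h) f =
  trans (cong₂ _+_ (sym (+-identityʳ (f zero))) (sumOver-partition h (f ∘ suc)))
        (interchange (f zero) 0ℚ (sumOver q (f ∘ suc)) (sumOver r (f ∘ suc)))
sumOver-partition (inʳ {q = q} {r} h) f =
  trans (cong₂ _+_ (sym (+-identityˡ (f zero))) (sumOver-partition h (f ∘ suc)))
        (interchange 0ℚ (f zero) (sumOver q (f ∘ suc)) (sumOver r (f ∘ suc)))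
sumOver-partition (out {q = q} {r} h) f =
  trans (cong₂ _+_ (sym (+-identityˡ 0ℚ)) (sumOver-partition h (f ∘ suc)))
        (interchange 0ℚ 0ℚ (sumOver q (f ∘ suc)) (sumOver r (f ∘ suc)))

sumOver-cong : ∀ p → (∀ i → f i ≡ g i) → sumOver p f ≡ sumOver p g
sumOver-cong []            f≗g = refl
sumOver-cong (inside  ∷ p) f≗g = cong₂ _+_ (f≗g zero) (sumOver-cong p (f≗g ∘ suc))
sumOver-cong (outside ∷ p) f≗g = cong (0ℚ +_) (sumOver-cong p (f≗g ∘ suc))

sumOver-+ : ∀ p (f g : Fin n → ℚ) → sumOver p (λ i → f i + g i) ≡ sumOver p f + sumOver p g
sumOver-+ []            f g = sym (+-identityʳ 0ℚ)
sumOver-+ (inside  ∷ p) f g = trans (cong (f zero + g zero +_) (sumOver-+ p (f ∘ suc) (g ∘ suc)))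
  (interchange (f zero) (g zero) (sumOver p (f ∘ suc)) (sumOver p (g ∘ suc)))
sumOver-+ (outside ∷ p) f g = trans (cong₂ _+_ (sym (+-identityˡ 0ℚ)) (sumOver-+ p (f ∘ suc) (g ∘ suc)))
  (interchange 0ℚ 0ℚ (sumOver p (f ∘ suc)) (sumOver p (g ∘ suc)))

sumOver-nonneg : ∀ p → (∀ i → 0ℚ ≤ f i) → 0ℚ ≤ sumOver p f
sumOver-nonneg []            f≥0 = ≤-refl
sumOver-nonneg (inside  ∷ p) f≥0 = +-mono-≤ (f≥0 zero) (sumOver-nonneg p (f≥0 ∘ suc))
sumOver-nonneg (outside ∷ p) f≥0 = +-mono-≤ ≤-refl (sumOver-nonneg p (f≥0 ∘ suc))

sumOver-const : ∀ (p : Subset n) x → sumOver p (λ _ → x) ≡ ℕ→ℚ ∣ p ∣ * x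
sumOver-const []            x = sym (*-zeroˡ x)
sumOver-const (inside  ∷ p) x = begin
  x + sumOver p (λ _ → x)         ≡⟨ cong₂ _+_ (sym (*-identityˡ x)) (sumOver-const p x) ⟩
  1ℚ * x + ℕ→ℚ ∣ p ∣ * x           ≡⟨ sym (*-distribʳ-+ x 1ℚ (ℕ→ℚ ∣ p ∣)) ⟩
  (1ℚ + ℕ→ℚ ∣ p ∣) * x             ≡⟨ cong (_* x) (sym (ℕ→ℚ-+ 1 ∣ p ∣)) ⟩
  ℕ→ℚ (suc ∣ p ∣) * x ∎
  where open ≡-Reasoning
sumOver-const (outside ∷ p) x = trans (+-identityˡ _) (sumOver-const p x)

sumOver-∩ : ∀ (p q : Subset n) f → sumOver p (λ i → if lookup q i then f i else 0ℚ) ≡ sumOver (p ∩ q) f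
sumOver-∩ []            []      f = refl
sumOver-∩ (inside  ∷ p) (b ∷ q) f = cong ((if b then f zero else 0ℚ) +_) (sumOver-∩ p q (f ∘ suc))
sumOver-∩ (outside ∷ p) (b ∷ q) f = cong (0ℚ +_) (sumOver-∩ p q (f ∘ suc))

sumFin-cong : ∀ {n} {f g : Fin n → ℚ} → (∀ i → f i ≡ g i) → sumFin f ≡ sumFin g
sumFin-cong {zero}  f≗g = refl
sumFin-cong {suc n} f≗g = cong₂ _+_ (f≗g zero) (sumFin-cong (f≗g ∘ suc))

sumFin≡sum : ∀ (f : Fin n → ℚ) → sumFin f ≡ sum f
sumFin≡sum {zero}  f = refl
sumFin≡sum {suc n} f = cong (f zero +_) (sumFin≡sum (f ∘ suc))

sumFin-comm : ∀ {m} (f : Fin m → Fin n → ℚ) →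
  sumFin (λ i → sumFin (f i)) ≡ sumFin (λ j → sumFin (λ i → f i j))
sumFin-comm f = begin
  sumFin (λ i → sumFin (f i))             ≡⟨ sumFin≡sum (λ i → sumFin (f i)) ⟩
  sum (λ i → sumFin (f i))                ≡⟨ sum-cong-≗ (λ i → sumFin≡sum (f i)) ⟩
  sum (λ i → sum (f i))                   ≡⟨ ∑-comm f ⟩
  sum (λ j → sum (λ i → f i j))           ≡⟨ sum-cong-≗ (λ j → sumFin≡sum (λ i → f i j)) ⟨
  sum (λ j → sumFin (λ i → f i j))        ≡⟨ sumFin≡sum (λ j → sumFin (λ i → f i j)) ⟨
  sumFin (λ j → sumFin (λ i → f i j)) ∎
  where open ≡-Reasoning

sumFin-lookup : ∀ (p : Subset n) f → sumFin (λ i → if lookup p i then f i else 0ℚ) ≡ sumOver p f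
sumFin-lookup []      f = refl
sumFin-lookup (b ∷ p) f = cong ((if b then f zero else 0ℚ) +_) (sumFin-lookup p (f ∘ suc))

between≡sumOver : ∀ {n} (w : Fin n → Fin n → ℚ) A B → between w A B ≡ sumOver A (λ i → sumOver B (w i))
between≡sumOver {n} w A B = trans (sumFin-cong (λ i → row (lookup A i) i)) (sumFin-lookup A _)
  where
  row : ∀ a i → sumFin (λ j → if a ∧ lookup B j then w i j else 0ℚ) ≡ (if a then sumOver B (w i) else 0ℚ)
  row true  i = sumFin-lookup B (w i)
  row false i = trans (sumFin≡sum {n} (λ _ → 0ℚ)) (sum-replicate-zero n)

module _ (G : WGraph n) where

  between-comm : ∀ A B → between (w G) A B ≡ between (w G) B A
  between-comm A B =
    trans (sumFin-comm (λ i j → if lookup A i ∧ lookup B j then w G i j else 0ℚ))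
          (sumFin-cong λ j → sumFin-cong λ i →
            cong₂ (λ b x → if b then x else 0ℚ) (∧-comm (lookup A i) (lookup B j)) (w-sym G i j))

  between-nonneg : ∀ A B → 0ℚ ≤ between (w G) A B
  between-nonneg A B = subst (0ℚ ≤_) (sym (between≡sumOver (w G) A B))
    (sumOver-nonneg A (λ i → sumOver-nonneg B (w-nonneg G i)))

between-partitionˡ : ∀ (w : Fin n → Fin n → ℚ) {A A₁ A₂} → Partition A A₁ A₂ → ∀ B →
  between w A B ≡ between w A₁ B + between w A₂ B
between-partitionˡ w {A} {A₁} {A₂} h B = begin
  between w A B                                 ≡⟨ between≡sumOver w A B ⟩
  sumOver A (row B)                             ≡⟨ sumOver-partition h (row B) ⟩
  sumOver A₁ (row B) + sumOver A₂ (row B)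
    ≡⟨ cong₂ _+_ (between≡sumOver w A₁ B) (between≡sumOver w A₂ B) ⟨
  between w A₁ B + between w A₂ B ∎
  where
  open ≡-Reasoning
  row : Subset _ → Fin _ → ℚ
  row B i = sumOver B (w i)

between-partitionʳ : ∀ (w : Fin n → Fin n → ℚ) A {B B₁ B₂} → Partition B B₁ B₂ →
  between w A B ≡ between w A B₁ + between w A B₂
between-partitionʳ w A {B} {B₁} {B₂} h = begin
  between w A B                                                 ≡⟨ between≡sumOver w A B ⟩
  sumOver A (λ i → sumOver B (w i))
    ≡⟨ sumOver-cong A (λ i → sumOver-partition h (w i)) ⟩
  sumOver A (λ i → sumOver B₁ (w i) + sumOver B₂ (w i))         ≡⟨ sumOver-+ A _ _ ⟩
  sumOver A (λ i → sumOver B₁ (w i)) + sumOver A (λ i → sumOver B₂ (w i))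
    ≡⟨ cong₂ _+_ (between≡sumOver w A B₁) (between≡sumOver w A B₂) ⟨
  between w A B₁ + between w A B₂ ∎
  where open ≡-Reasoning

between-mono-⊆ : ∀ (G : WGraph n) {A A′ B B′} → A ⊆ A′ → B ⊆ B′ → between (w G) A B ≤ between (w G) A′ B′
between-mono-⊆ G {A} {A′} {B} {B′} A⊆A′ B⊆B′ = begin
  between (w G) A B                                       ≤⟨ x≤x+y (between-nonneg G A (B′ ∩ ∁ B)) ⟩
  between (w G) A B + between (w G) A (B′ ∩ ∁ B)          ≡⟨ between-partitionʳ (w G) A (⊆⇒partition B⊆B′) ⟨
  between (w G) A B′                                      ≤⟨ x≤x+y (between-nonneg G (A′ ∩ ∁ A) B′) ⟩
  between (w G) A B′ + between (w G) (A′ ∩ ∁ A) B′        ≡⟨ between-partitionˡ (w G) (⊆⇒partition A⊆A′) B′ ⟨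
  between (w G) A′ B′ ∎
  where open ≤-Reasoning

-- Cuts of the auxiliary graph

stCutCost : (Fin n → Fin n → ℚ) → (T S : Subset n) → ℚ → Subset n → ℚ
stCutCost w T S c Y = cutWeight w Y + (ℕ→ℚ ∣ ∁ Y ∩ S ∣ * c + ℕ→ℚ ∣ Y ∩ (T ∩ ∁ S) ∣ * c)

lookup-∩∁ : ∀ (p q : Subset n) i → lookup (p ∩ ∁ q) i ≡ lookup p i ∧ not (lookup q i)
lookup-∩∁ p q i = trans (lookup-zipWith _∧_ i p (∁ q)) (cong (lookup p i ∧_) (lookup-map i not q))

-- In the first step the rows and columns of σ and τ unfold definitionally.
cutWeight-augW : ∀ (w : Fin n → Fin n → ℚ) T S c Y →
  cutWeight (augW w T S c) (inside ∷ outside ∷ Y) ≡ stCutCost w T S c Y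
cutWeight-augW w T S c Y = begin
  cutWeight (augW w T S c) (inside ∷ outside ∷ Y)
    ≡⟨ between≡sumOver (augW w T S c) (inside ∷ outside ∷ Y) (outside ∷ inside ∷ ∁ Y) ⟩
  (0ℚ + (0ℚ + sumOver (∁ Y) toσ)) + (0ℚ + sumOver Y (λ i → 0ℚ + (toτ i + row i)))
    ≡⟨ cong₂ _+_ (trans (+-identityˡ (0ℚ + sumOver (∁ Y) toσ)) (+-identityˡ (sumOver (∁ Y) toσ)))
                 (trans (+-identityˡ _) (sumOver-cong Y (λ i → +-identityˡ (toτ i + row i)))) ⟩
  sumOver (∁ Y) toσ + sumOver Y (λ i → toτ i + row i)
    ≡⟨ cong (sumOver (∁ Y) toσ +_) (sumOver-+ Y toτ row) ⟩
  sumOver (∁ Y) toσ + (sumOver Y toτ + sumOver Y row)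
    ≡⟨ cong₂ (λ a b → a + (b + sumOver Y row)) σ-edges τ-edges ⟩
  capσ + (capτ + sumOver Y row)
    ≡⟨ rearrange capσ capτ (sumOver Y row) ⟩
  sumOver Y row + (capσ + capτ)
    ≡⟨ cong (_+ (capσ + capτ)) (between≡sumOver w Y (∁ Y)) ⟨
  stCutCost w T S c Y ∎
  where
  open ≡-Reasoning
  toσ toτ row : Fin _ → ℚ
  toσ j = if lookup S j then c else 0ℚ
  toτ i = if lookup T i ∧ not (lookup S i) then c else 0ℚ
  row i = sumOver (∁ Y) (w i)
  capσ capτ : ℚ
  capσ = ℕ→ℚ ∣ ∁ Y ∩ S ∣ * c
  capτ = ℕ→ℚ ∣ Y ∩ (T ∩ ∁ S) ∣ * c
  σ-edges : sumOver (∁ Y) toσ ≡ capσ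
  σ-edges = trans (sumOver-∩ (∁ Y) S (λ _ → c)) (sumOver-const (∁ Y ∩ S) c)
  τ-edges : sumOver Y toτ ≡ capτ
  τ-edges = begin
    sumOver Y toτ
      ≡⟨ sumOver-cong Y (λ i → cong (if_then c else 0ℚ) (lookup-∩∁ T S i)) ⟨
    sumOver Y (λ i → if lookup (T ∩ ∁ S) i then c else 0ℚ) ≡⟨ sumOver-∩ Y (T ∩ ∁ S) (λ _ → c) ⟩
    sumOver (Y ∩ (T ∩ ∁ S)) (λ _ → c)                     ≡⟨ sumOver-const (Y ∩ (T ∩ ∁ S)) c ⟩
    capτ ∎
  rearrange : ∀ a b d → a + (b + d) ≡ d + (a + b)
  rearrange = solve-∀ ℚ-ring

capacity-partition : ∀ c → Partition p q r → ℕ→ℚ ∣ p ∣ * c ≡ ℕ→ℚ ∣ q ∣ * c + ℕ→ℚ ∣ r ∣ * c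
capacity-partition {p = p} {q} {r} c h = begin
  ℕ→ℚ ∣ p ∣ * c                      ≡⟨ cong (λ m → ℕ→ℚ m * c) (∣∣-partition h) ⟩
  ℕ→ℚ (∣ q ∣ ℕ.+ ∣ r ∣) * c            ≡⟨ cong (_* c) (ℕ→ℚ-+ ∣ q ∣ ∣ r ∣) ⟩
  (ℕ→ℚ ∣ q ∣ + ℕ→ℚ ∣ r ∣) * c          ≡⟨ *-distribʳ-+ c (ℕ→ℚ ∣ q ∣) (ℕ→ℚ ∣ r ∣) ⟩
  ℕ→ℚ ∣ q ∣ * c + ℕ→ℚ ∣ r ∣ * c ∎
  where open ≡-Reasoning

capacity-nonneg : ∀ m {c} → 0ℚ ≤ c → 0ℚ ≤ ℕ→ℚ m * c
capacity-nonneg m {c} 0≤c = subst (_≤ ℕ→ℚ m * c) (*-zeroˡ c)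
  (*-monoʳ-≤-nonNeg c {{nonNegative 0≤c}} (ℕ→ℚ-mono-≤ {0} {m} ℕ.z≤n))

isMinSTCut⇒minimal : ∀ (w : Fin n → Fin n → ℚ) T S c U →
  IsMinSTCut (augW w T S c) (inside ∷ outside ∷ U) → ∀ Y → stCutCost w T S c U ≤ stCutCost w T S c Y
isMinSTCut⇒minimal w T S c U (_ , minimal) Y =
  subst₂ _≤_ (cutWeight-augW w T S c U) (cutWeight-augW w T S c Y) (minimal (inside ∷ outside ∷ Y) (refl , refl))

sumOver-⊥ : ∀ n (f : Fin n → ℚ) → sumOver ⊥ f ≡ 0ℚ
sumOver-⊥ zero    f = refl
sumOver-⊥ (suc n) f = trans (+-identityˡ (sumOver ⊥ (f ∘ suc))) (sumOver-⊥ n (f ∘ suc))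

between-⊥ʳ : ∀ (w : Fin n → Fin n → ℚ) A → between w A ⊥ ≡ 0ℚ
between-⊥ʳ {n} w A = begin
  between w A ⊥                        ≡⟨ between≡sumOver w A ⊥ ⟩
  sumOver A (λ i → sumOver ⊥ (w i))    ≡⟨ sumOver-cong A (λ i → sumOver-⊥ n (w i)) ⟩
  sumOver A (λ _ → 0ℚ)                 ≡⟨ sumOver-const A 0ℚ ⟩
  ℕ→ℚ ∣ A ∣ * 0ℚ                        ≡⟨ *-zeroʳ (ℕ→ℚ ∣ A ∣) ⟩
  0ℚ ∎
  where open ≡-Reasoning

stCutCost-⊤ : ∀ (w : Fin n → Fin n → ℚ) T S c → stCutCost w T S c ⊤ ≡ ℕ→ℚ ∣ T ∩ ∁ S ∣ * c
stCutCost-⊤ {n} w T S c = begin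
  between w ⊤ (∁ ⊤) + (ℕ→ℚ ∣ ∁ ⊤ ∩ S ∣ * c + ℕ→ℚ ∣ ⊤ ∩ (T ∩ ∁ S) ∣ * c)
    ≡⟨ cong₂ (λ X m → between w ⊤ X + (ℕ→ℚ ∣ X ∩ S ∣ * c + ℕ→ℚ m * c))
             (∁⊤≡⊥ n) (cong ∣_∣ (∩-identityˡ (T ∩ ∁ S))) ⟩
  between w ⊤ ⊥ + (ℕ→ℚ ∣ ⊥ ∩ S ∣ * c + ℕ→ℚ ∣ T ∩ ∁ S ∣ * c)
    ≡⟨ cong₂ (λ x m → x + (ℕ→ℚ m * c + ℕ→ℚ ∣ T ∩ ∁ S ∣ * c))
             (between-⊥ʳ w ⊤) (trans (cong ∣_∣ (∩-zeroˡ S)) (∣⊥∣≡0 n)) ⟩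
  0ℚ + (0ℚ * c + ℕ→ℚ ∣ T ∩ ∁ S ∣ * c)
    ≡⟨ trans (+-identityˡ _) (trans (cong (_+ ℕ→ℚ ∣ T ∩ ∁ S ∣ * c) (*-zeroˡ c)) (+-identityˡ _)) ⟩
  ℕ→ℚ ∣ T ∩ ∁ S ∣ * c ∎
  where open ≡-Reasoning

thirds : ∀ a p q → p ℕ.≤ q → 2 ℕ.* ((a ℕ.+ p) ℕ.+ q) ℕ.≤ 3 ℕ.* (a ℕ.+ p) → (a ℕ.+ p) ℕ.+ q ℕ.≤ 3 ℕ.* a
thirds a p q p≤q h = begin
  (a ℕ.+ p) ℕ.+ q     ≤⟨ ℕ.+-mono-≤ (ℕ.+-monoʳ-≤ a (ℕ.≤-trans p≤q q≤a)) q≤a ⟩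
  (a ℕ.+ a) ℕ.+ a     ≡⟨ triple a ⟩
  3 ℕ.* a ∎
  where
  open ℕ.≤-Reasoning
  triple : ∀ a → (a ℕ.+ a) ℕ.+ a ≡ 3 ℕ.* a
  triple = ℕ-Solver.solve-∀
  split₂ : ∀ a p q → 2 ℕ.* ((a ℕ.+ p) ℕ.+ q) ≡ 2 ℕ.* (a ℕ.+ p) ℕ.+ 2 ℕ.* q
  split₂ = ℕ-Solver.solve-∀
  split₃ : ∀ a p → 3 ℕ.* (a ℕ.+ p) ≡ 2 ℕ.* (a ℕ.+ p) ℕ.+ (a ℕ.+ p)
  split₃ = ℕ-Solver.solve-∀
  double : ∀ q → q ℕ.+ q ≡ 2 ℕ.* q
  double = ℕ-Solver.solve-∀
  2q≤a+p : 2 ℕ.* q ℕ.≤ a ℕ.+ p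
  2q≤a+p = ℕ.+-cancelˡ-≤ (2 ℕ.* (a ℕ.+ p)) _ _ (subst₂ ℕ._≤_ (split₂ a p q) (split₃ a p) h)
  q≤a : q ℕ.≤ a
  q≤a = ℕ.+-cancelʳ-≤ p q a (begin
    q ℕ.+ p      ≤⟨ ℕ.+-monoʳ-≤ q p≤q ⟩
    q ℕ.+ q      ≡⟨ double q ⟩
    2 ℕ.* q      ≤⟨ 2q≤a+p ⟩
    a ℕ.+ p ∎)

module MinimalCut (G : WGraph n) (T S : Subset n) (c : ℚ) (U : Subset n)
                  (U-minimal : ∀ Y → stCutCost (w G) T S c U ≤ stCutCost (w G) T S c Y) where

  exchange : ∀ {X Y} → Partition U X Y →
    between (w G) X (∁ U) + ℕ→ℚ ∣ X ∩ (T ∩ ∁ S) ∣ * c ≤ between (w G) Y X + ℕ→ℚ ∣ X ∩ S ∣ * c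
  exchange {X} {Y} h = +-cancelʳ-≤ (b + (e + tY)) (begin
    (a + tX) + (b + (e + tY))      ≡⟨ shuffleˡ a b e tX tY ⟩
    (a + b) + (e + (tX + tY))      ≡⟨ cong₂ (λ u v → u + (e + v)) (between-partitionˡ (w G) h (∁ U))
                                                                 (capacity-partition c (Partition-∩ʳ h (T ∩ ∁ S))) ⟨
    stCutCost (w G) T S c U            ≤⟨ U-minimal Y ⟩
    stCutCost (w G) T S c Y
      ≡⟨ cong₂ (λ u v → u + (v + tY)) (between-partitionʳ (w G) Y (Partition-∁ h))
                                                                 (capacity-partition c (Partition-∩ʳ (Partition-∁ h) S)) ⟩
    (b + x) + ((e + sX) + tY)      ≡⟨ shuffleʳ b x e sX tY ⟩
    (x + sX) + (b + (e + tY)) ∎)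
    where
    open ≤-Reasoning
    a b e tX tY x sX : ℚ
    a  = between (w G) X (∁ U)
    b  = between (w G) Y (∁ U)
    e  = ℕ→ℚ ∣ ∁ U ∩ S ∣ * c
    tX = ℕ→ℚ ∣ X ∩ (T ∩ ∁ S) ∣ * c
    tY = ℕ→ℚ ∣ Y ∩ (T ∩ ∁ S) ∣ * c
    x  = between (w G) Y X
    sX = ℕ→ℚ ∣ X ∩ S ∣ * c
    shuffleˡ : ∀ a b e t t′ → (a + t) + (b + (e + t′)) ≡ (a + b) + (e + (t + t′))
    shuffleˡ = solve-∀ ℚ-ring
    shuffleʳ : ∀ b x e s t′ → (b + x) + ((e + s) + t′) ≡ (x + s) + (b + (e + t′))
    shuffleʳ = solve-∀ ℚ-ring

  no-sources⇒c≤ : S ⊆ T → 0ℚ ≤ c → ∀ {X Y} → Partition U X Y →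
    ∣ X ∩ S ∣ ≡ 0 → 0 ℕ.< ∣ X ∩ T ∣ → c ≤ between (w G) Y X
  no-sources⇒c≤ S⊆T 0≤c {X} {Y} h X∩S≡∅ X∩T≢∅ = begin
    c                                                            ≡⟨ *-identityˡ c ⟨
    ℕ→ℚ 1 * c
      ≤⟨ *-monoʳ-≤-nonNeg c {{nonNegative 0≤c}} (ℕ→ℚ-mono-≤ X∩T∖S≢∅) ⟩
    ℕ→ℚ ∣ X ∩ (T ∩ ∁ S) ∣ * c                                    ≤⟨ x≤y+x (between-nonneg G X (∁ U)) ⟩
    between (w G) X (∁ U) + ℕ→ℚ ∣ X ∩ (T ∩ ∁ S) ∣ * c            ≤⟨ exchange h ⟩
    between (w G) Y X + ℕ→ℚ ∣ X ∩ S ∣ * c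
      ≡⟨ cong (λ m → between (w G) Y X + ℕ→ℚ m * c) X∩S≡∅ ⟩
    between (w G) Y X + 0ℚ * c
      ≡⟨ trans (cong (between (w G) Y X +_) (*-zeroˡ c)) (+-identityʳ _) ⟩
    between (w G) Y X ∎
    where
    open ≤-Reasoning
    X∩T∖S≢∅ : 1 ℕ.≤ ∣ X ∩ (T ∩ ∁ S) ∣
    X∩T∖S≢∅ = subst (0 ℕ.<_)
      (trans (∣∣-partition (Partition-∩ˡ (⊆⇒partition S⊆T) X)) (cong (ℕ._+ ∣ X ∩ (T ∩ ∁ S) ∣) X∩S≡∅))
      X∩T≢∅

  ∣∁U∩S∣≤∣T∩∁S∣ : 0ℚ < c → ∣ ∁ U ∩ S ∣ ℕ.≤ ∣ T ∩ ∁ S ∣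
  ∣∁U∩S∣≤∣T∩∁S∣ 0<c = ℕ→ℚ-cancel-≤ (*-cancelʳ-≤-pos c {{positive 0<c}} (begin
    ℕ→ℚ ∣ ∁ U ∩ S ∣ * c
      ≤⟨ x≤x+y (capacity-nonneg ∣ U ∩ (T ∩ ∁ S) ∣ (<⇒≤ 0<c)) ⟩
    ℕ→ℚ ∣ ∁ U ∩ S ∣ * c + ℕ→ℚ ∣ U ∩ (T ∩ ∁ S) ∣ * c            ≤⟨ x≤y+x (between-nonneg G U (∁ U)) ⟩
    stCutCost (w G) T S c U                                    ≤⟨ U-minimal ⊤ ⟩
    stCutCost (w G) T S c ⊤                                    ≡⟨ stCutCost-⊤ (w G) T S c ⟩
    ℕ→ℚ ∣ T ∩ ∁ S ∣ * c ∎))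
    where open ≤-Reasoning

  ∣T∣≤3∣U∩T∣ : S ⊆ T → 2 ℕ.* ∣ T ∣ ℕ.≤ 3 ℕ.* ∣ S ∣ → 0ℚ < c → ∣ T ∣ ℕ.≤ 3 ℕ.* ∣ U ∩ T ∣
  ∣T∣≤3∣U∩T∣ S⊆T 2∣T∣≤3∣S∣ 0<c = begin
    ∣ T ∣                                          ≡⟨ ∣T∣≡ ⟩
    (∣ U ∩ S ∣ ℕ.+ ∣ ∁ U ∩ S ∣) ℕ.+ ∣ T ∩ ∁ S ∣
      ≤⟨ thirds _ _ _ (∣∁U∩S∣≤∣T∩∁S∣ 0<c) (subst₂ (λ t s → 2 ℕ.* t ℕ.≤ 3 ℕ.* s) ∣T∣≡ ∣S∣≡ 2∣T∣≤3∣S∣) ⟩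
    3 ℕ.* ∣ U ∩ S ∣                                ≤⟨ ℕ.*-monoʳ-≤ 3 (p⊆q⇒∣p∣≤∣q∣ (∩-monoʳ-⊆ U S⊆T)) ⟩
    3 ℕ.* ∣ U ∩ T ∣ ∎
    where
    open ℕ.≤-Reasoning
    ∣S∣≡ : ∣ S ∣ ≡ ∣ U ∩ S ∣ ℕ.+ ∣ ∁ U ∩ S ∣
    ∣S∣≡ = ∣∣-partition (∩-∁-partition U S)
    ∣T∣≡ : ∣ T ∣ ≡ (∣ U ∩ S ∣ ℕ.+ ∣ ∁ U ∩ S ∣) ℕ.+ ∣ T ∩ ∁ S ∣
    ∣T∣≡ = trans (∣∣-partition (⊆⇒partition S⊆T)) (cong (ℕ._+ ∣ T ∩ ∁ S ∣) ∣S∣≡)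

÷-*-cancel : ∀ p q .{{_ : Data.Rational.NonZero q}} → (p ÷ q) * q ≡ p
÷-*-cancel p q = trans (*-assoc p (1/ q) q) (trans (cong (p *_) (*-inverseˡ q)) (*-identityʳ p))

module _ (s γ : ℚ) (hs : 0ℚ < s) where
  private
    κ = kappa s γ hs
    2s-pos : Positive (ℕ→ℚ 2 * s)
    2s-pos = pos*pos⇒pos (ℕ→ℚ 2) s {{positive hs}}
    instance
      2s-nonZero : Data.Rational.NonZero (ℕ→ℚ 2 * s)
      2s-nonZero = pos⇒nonZero (ℕ→ℚ 2 * s) {{2s-pos}}
      2s-nonNeg : Data.Rational.NonNegative (ℕ→ℚ 2 * s)
      2s-nonNeg = pos⇒nonNeg (ℕ→ℚ 2 * s) {{2s-pos}}

  kappa*6≤γ : κ * ℕ→ℚ 6 ≤ γ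
  kappa*6≤γ = ≤-trans (*-monoʳ-≤-nonNeg (ℕ→ℚ 6) (p⊓q≤q (γ ÷ (ℕ→ℚ 2 * s)) (γ ÷ ℕ→ℚ 6)))
    (≤-reflexive (÷-*-cancel γ (ℕ→ℚ 6)))

  kappa*2s≤γ : κ * (ℕ→ℚ 2 * s) ≤ γ
  kappa*2s≤γ = ≤-trans (*-monoʳ-≤-nonNeg (ℕ→ℚ 2 * s) (p⊓q≤p (γ ÷ (ℕ→ℚ 2 * s)) (γ ÷ ℕ→ℚ 6)))
    (≤-reflexive (÷-*-cancel γ (ℕ→ℚ 2 * s)))

  kappa-budget : 0ℚ ≤ γ → κ + (κ + s * κ) ≤ γ
  kappa-budget 0≤γ = *-cancelʳ-≤-pos (ℕ→ℚ 6) (begin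
    (κ + (κ + s * κ)) * ℕ→ℚ 6                       ≡⟨ expand κ s ⟩
    (κ * ℕ→ℚ 6 + κ * ℕ→ℚ 6) + (κ * (ℕ→ℚ 2 * s) + (κ * (ℕ→ℚ 2 * s) + κ * (ℕ→ℚ 2 * s)))
      ≤⟨ +-mono-≤ (+-mono-≤ kappa*6≤γ kappa*6≤γ) (+-mono-≤ kappa*2s≤γ (+-mono-≤ kappa*2s≤γ kappa*2s≤γ)) ⟩
    (γ + γ) + (γ + (γ + γ))                         ≤⟨ x≤x+y 0≤γ ⟩
    (γ + γ) + (γ + (γ + γ)) + γ                     ≡⟨ six γ ⟩
    γ * ℕ→ℚ 6 ∎)
    where
    open ≤-Reasoning
    expand : ∀ κ s → (κ + (κ + s * κ)) * (1ℚ + 1ℚ + 1ℚ + 1ℚ + 1ℚ + 1ℚ) ≡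
      (κ * (1ℚ + 1ℚ + 1ℚ + 1ℚ + 1ℚ + 1ℚ) + κ * (1ℚ + 1ℚ + 1ℚ + 1ℚ + 1ℚ + 1ℚ)) +
      (κ * ((1ℚ + 1ℚ) * s) + (κ * ((1ℚ + 1ℚ) * s) + κ * ((1ℚ + 1ℚ) * s)))
    expand = solve-∀ ℚ-ring
    six : ∀ γ → (γ + γ) + (γ + (γ + γ)) + γ ≡ γ * (1ℚ + 1ℚ + 1ℚ + 1ℚ + 1ℚ + 1ℚ)
    six = solve-∀ ℚ-ring

s+[r+s]≤[2r+s]⊔3s : ∀ r s → s + (r + s) ≤ (ℕ→ℚ 2 * r + s) ⊔ (ℕ→ℚ 3 * s)
s+[r+s]≤[2r+s]⊔3s r s with ≤-total s r
... | inj₁ s≤r = p≤q⇒p≤q⊔r (ℕ→ℚ 3 * s) (begin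
  s + (r + s)             ≤⟨ +-monoˡ-≤ (r + s) s≤r ⟩
  r + (r + s)             ≡⟨ twice r s ⟩
  ℕ→ℚ 2 * r + s ∎)
  where
  open ≤-Reasoning
  twice : ∀ r s → r + (r + s) ≡ (1ℚ + 1ℚ) * r + s
  twice = solve-∀ ℚ-ring
... | inj₂ r≤s = p≤q⇒p≤r⊔q (ℕ→ℚ 2 * r + s) (begin
  s + (r + s)             ≤⟨ +-monoʳ-≤ s (+-monoˡ-≤ s r≤s) ⟩
  s + (s + s)             ≡⟨ thrice s ⟩
  ℕ→ℚ 3 * s ∎)
  where
  open ≤-Reasoning
  thrice : ∀ s → s + (s + s) ≡ (1ℚ + 1ℚ + 1ℚ) * s
  thrice = solve-∀ ℚ-ring

-- Terminal-strongness of the source side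

cutWeight-∁ : ∀ (G : WGraph n) C → cutWeight (w G) (∁ C) ≡ cutWeight (w G) C
cutWeight-∁ G C = trans (cong (between (w G) (∁ C)) (∁-involutive C)) (between-comm G (∁ C) C)

StrongAt : WGraph n → (s δ γ : ℚ) → (X U C : Subset n) → Set
StrongAt G s δ γ X U C =
  (ℕ→ℚ (∣ C ∩ U ∩ X ∣ ℕ.⊓ ∣ ∁ C ∩ U ∩ X ∣) ≤ s)
  × (0 ℕ.< ∣ C ∩ U ∩ X ∣ → 0 ℕ.< ∣ ∁ C ∩ U ∩ X ∣ → γ * δ ≤ inducedCutWeight (w G) U C)

StrongAt-∁ : ∀ (G : WGraph n) {s δ γ X U} C → StrongAt G s δ γ X U (∁ C) → StrongAt G s δ γ X U C
StrongAt-∁ G {s} {δ} {γ} {X} {U} C h = swap (subst Flipped (∁-involutive C) h)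
  where
  Flipped : Subset _ → Set
  Flipped D = (ℕ→ℚ (∣ ∁ C ∩ U ∩ X ∣ ℕ.⊓ ∣ D ∩ U ∩ X ∣) ≤ s)
    × (0 ℕ.< ∣ ∁ C ∩ U ∩ X ∣ → 0 ℕ.< ∣ D ∩ U ∩ X ∣ → γ * δ ≤ between (w G) (∁ C ∩ U) (D ∩ U))
  swap : Flipped C → StrongAt G s δ γ X U C
  swap (few , cross) =
    subst (λ m → ℕ→ℚ m ≤ s) (ℕ.⊓-comm ∣ ∁ C ∩ U ∩ X ∣ ∣ C ∩ U ∩ X ∣) few ,
    λ C∩U∩X≢∅ ∁C∩U∩X≢∅ →
      subst (γ * δ ≤_) (between-comm G (∁ C ∩ U) (C ∩ U)) (cross ∁C∩U∩X≢∅ C∩U∩X≢∅)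

module MinCutSourceSide (G : WGraph n) (T S : Subset n) (s δ γ : ℚ) (S⊆T : S ⊆ T)
                        (hs : 0ℚ < s) (hδ : 0ℚ < δ) (hγ : 0ℚ < γ)
                        (strong : TerminalStrong G T s δ γ S ⊤) (U : Subset n)
                        (U-minimal : ∀ Y → stCutCost (w G) T S (δ * kappa s γ hs) U
                                         ≤ stCutCost (w G) T S (δ * kappa s γ hs) Y) where

  κ c bound : ℚ
  κ = kappa s γ hs
  c = δ * κ
  bound = (twoOverKappa s γ hs hγ + s) ⊔ (ℕ→ℚ 3 * s)

  c-pos : Positive c
  c-pos = pos*pos⇒pos δ {{positive hδ}} κ {{kappa-pos s γ hs hγ}}

  0≤c : 0ℚ ≤ c
  0≤c = <⇒≤ (positive⁻¹ c {{c-pos}})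

  instance
    κ-nonZero : Data.Rational.NonZero κ
    κ-nonZero = pos⇒nonZero κ {{kappa-pos s γ hs hγ}}

  open MinimalCut G T S c U U-minimal public

  capacity-budget : c + (c + s * c) ≤ γ * δ
  capacity-budget = begin
    c + (c + s * c)             ≡⟨ factor δ κ s ⟩
    δ * (κ + (κ + s * κ))
      ≤⟨ *-monoˡ-≤-nonNeg δ {{nonNegative (<⇒≤ hδ)}} (kappa-budget s γ hs (<⇒≤ hγ)) ⟩
    δ * γ                       ≡⟨ *-comm δ γ ⟩
    γ * δ ∎
    where
    open ≤-Reasoning
    factor : ∀ δ κ s → δ * κ + (δ * κ + s * (δ * κ)) ≡ δ * (κ + (κ + s * κ))
    factor = solve-∀ ℚ-ring

  capacity≤⇒card≤ : ∀ m → ℕ→ℚ m * c ≤ δ + s * c → ℕ→ℚ m ≤ 1/ κ + s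
  capacity≤⇒card≤ m h = *-cancelʳ-≤-pos c {{c-pos}} (subst (ℕ→ℚ m * c ≤_) δ+sc≡ h)
    where
    distrib : ∀ r s δ κ → (r + s) * (δ * κ) ≡ δ * (r * κ) + s * (δ * κ)
    distrib = solve-∀ ℚ-ring
    δ+sc≡ : δ + s * c ≡ (1/ κ + s) * c
    δ+sc≡ = begin
      δ + s * c                   ≡⟨ cong (_+ s * c) (*-identityʳ δ) ⟨
      δ * 1ℚ + s * c              ≡⟨ cong (λ x → δ * x + s * c) (*-inverseˡ κ) ⟨
      δ * (1/ κ * κ) + s * c      ≡⟨ distrib (1/ κ) s δ κ ⟨
      (1/ κ + s) * c ∎
      where open ≡-Reasoning

  fewer-sources≤s : ∀ C → SteinerCut T C → cutWeight (w G) C ≤ δ →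
                    ℕ→ℚ (∣ C ∩ S ∣ ℕ.⊓ ∣ ∁ C ∩ S ∣) ≤ s
  fewer-sources≤s C st hC = subst₂ (λ x y → ℕ→ℚ (∣ x ∣ ℕ.⊓ ∣ y ∣) ≤ s)
    (cong (C ∩_) (∩-identityˡ S)) (cong (∁ C ∩_) (∩-identityˡ S)) (proj₁ (strong C st hC))

  crossing⇒γδ≤cut : ∀ D → cutWeight (w G) D ≤ δ → 0 ℕ.< ∣ D ∩ S ∣ → 0 ℕ.< ∣ ∁ D ∩ S ∣ →
                    γ * δ ≤ cutWeight (w G) D
  crossing⇒γδ≤cut D hD D∩S≢∅ ∁D∩S≢∅ =
    subst (γ * δ ≤_) (cong₂ (between (w G)) (∩-identityʳ D) (∩-identityʳ (∁ D)))
      (proj₂ (strong D steiner hD) (subst (λ x → 0 ℕ.< ∣ x ∣) (sym (cong (D ∩_) (∩-identityˡ S))) D∩S≢∅)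
                                   (subst (λ x → 0 ℕ.< ∣ x ∣) (sym (cong (∁ D ∩_) (∩-identityˡ S))) ∁D∩S≢∅))
    where
    steiner : SteinerCut T D
    steiner = let i , i∈ = ∣p∣>0⇒nonempty (D ∩ S) D∩S≢∅ ; j , j∈ = ∣p∣>0⇒nonempty (∁ D ∩ S) ∁D∩S≢∅
              in (i , ∩-monoʳ-⊆ D S⊆T i∈) , (j , ∩-monoʳ-⊆ (∁ D) S⊆T j∈)

  module _ (C : Subset n) (hC : cutWeight (w G) C ≤ δ) (C∩S≤s : ℕ→ℚ ∣ C ∩ S ∣ ≤ s) where

    induced≤δ : inducedCutWeight (w G) U C ≤ δ
    induced≤δ = ≤-trans (between-mono-⊆ G (p∩q⊆p C U) (p∩q⊆p (∁ C) U)) hC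

    C∩U∩S≤s : ℕ→ℚ ∣ (C ∩ U) ∩ S ∣ ≤ s
    C∩U∩S≤s = ≤-trans (ℕ→ℚ-mono-≤ (p⊆q⇒∣p∣≤∣q∣ (∩-monoˡ-⊆ S (p∩q⊆p C U)))) C∩S≤s

    exchange-C∩U : between (w G) (C ∩ U) (∁ U) + ℕ→ℚ ∣ (C ∩ U) ∩ (T ∩ ∁ S) ∣ * c
                 ≤ inducedCutWeight (w G) U C + s * c
    exchange-C∩U = begin
      between (w G) (C ∩ U) (∁ U) + ℕ→ℚ ∣ (C ∩ U) ∩ (T ∩ ∁ S) ∣ * c  ≤⟨ exchange (∩-∁-partition C U) ⟩
      between (w G) (∁ C ∩ U) (C ∩ U) + ℕ→ℚ ∣ (C ∩ U) ∩ S ∣ * c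
        ≡⟨ cong (_+ ℕ→ℚ ∣ (C ∩ U) ∩ S ∣ * c) (between-comm G (∁ C ∩ U) (C ∩ U)) ⟩
      inducedCutWeight (w G) U C + ℕ→ℚ ∣ (C ∩ U) ∩ S ∣ * c
        ≤⟨ +-monoʳ-≤ (inducedCutWeight (w G) U C) (*-monoʳ-≤-nonNeg c {{nonNegative 0≤c}} C∩U∩S≤s) ⟩
      inducedCutWeight (w G) U C + s * c ∎
      where open ≤-Reasoning

    ∣C∩U∩T∣≤ : ℕ→ℚ ∣ (C ∩ U) ∩ T ∣ ≤ bound
    ∣C∩U∩T∣≤ = begin
      ℕ→ℚ ∣ (C ∩ U) ∩ T ∣
        ≡⟨ cong ℕ→ℚ (∣∣-partition (Partition-∩ˡ (⊆⇒partition S⊆T) (C ∩ U))) ⟩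
      ℕ→ℚ (∣ (C ∩ U) ∩ S ∣ ℕ.+ ∣ (C ∩ U) ∩ (T ∩ ∁ S) ∣)
        ≡⟨ ℕ→ℚ-+ ∣ (C ∩ U) ∩ S ∣ ∣ (C ∩ U) ∩ (T ∩ ∁ S) ∣ ⟩
      ℕ→ℚ ∣ (C ∩ U) ∩ S ∣ + ℕ→ℚ ∣ (C ∩ U) ∩ (T ∩ ∁ S) ∣
        ≤⟨ +-mono-≤ C∩U∩S≤s (capacity≤⇒card≤ ∣ (C ∩ U) ∩ (T ∩ ∁ S) ∣ sinks) ⟩
      s + (1/ κ + s)                                            ≤⟨ s+[r+s]≤[2r+s]⊔3s (1/ κ) s ⟩
      bound ∎
      where
      open ≤-Reasoning
      sinks : ℕ→ℚ ∣ (C ∩ U) ∩ (T ∩ ∁ S) ∣ * c ≤ δ + s * c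
      sinks = ≤-trans (x≤y+x (between-nonneg G (C ∩ U) (∁ U))) (≤-trans exchange-C∩U (+-monoˡ-≤ (s * c) induced≤δ))

    sources-on-both-sides⇒c≤ : 0 ℕ.< ∣ (C ∩ U) ∩ S ∣ → 0 ℕ.< ∣ (∁ C ∩ U) ∩ S ∣ →
                               c ≤ inducedCutWeight (w G) U C
    sources-on-both-sides⇒c≤ C∩U∩S≢∅ ∁C∩U∩S≢∅ = by-cases (inducedCutWeight (w G) U C <? c)
      where
      by-cases : Dec (inducedCutWeight (w G) U C < c) → c ≤ inducedCutWeight (w G) U C
      by-cases (no induced≮c)  = ≮⇒≥ induced≮c
      by-cases (yes induced<c) = contradiction (<-≤-trans ∂[C∩U]<γδ γδ≤∂[C∩U]) (<-irrefl refl)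
        where
        ∂[C∩U]<γδ : cutWeight (w G) (C ∩ U) < γ * δ
        ∂[C∩U]<γδ = begin-strict
          cutWeight (w G) (C ∩ U)
            ≡⟨ between-partitionʳ (w G) (C ∩ U) (Partition-swap (Partition-∁ (Partition-swap (∩-∁-partition C U)))) ⟩
          inducedCutWeight (w G) U C + between (w G) (C ∩ U) (∁ U)
            <⟨ +-mono-<-≤ induced<c (≤-trans (x≤x+y (capacity-nonneg ∣ (C ∩ U) ∩ (T ∩ ∁ S) ∣ 0≤c))
                                    (≤-trans exchange-C∩U (+-monoˡ-≤ (s * c) (<⇒≤ induced<c)))) ⟩
          c + (c + s * c)
            ≤⟨ capacity-budget ⟩
          γ * δ ∎
          where open ≤-Reasoning
        γδ≤∂C : γ * δ ≤ cutWeight (w G) C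
        γδ≤∂C = crossing⇒γδ≤cut C hC
          (ℕ.<-≤-trans C∩U∩S≢∅ (p⊆q⇒∣p∣≤∣q∣ (∩-monoˡ-⊆ S (p∩q⊆p C U))))
          (ℕ.<-≤-trans ∁C∩U∩S≢∅ (p⊆q⇒∣p∣≤∣q∣ (∩-monoˡ-⊆ S (p∩q⊆p (∁ C) U))))
        γδ≤∂[C∩U] : γ * δ ≤ cutWeight (w G) (C ∩ U)
        γδ≤∂[C∩U] = crossing⇒γδ≤cut (C ∩ U) (≤-trans (<⇒≤ ∂[C∩U]<γδ) (≤-trans γδ≤∂C hC))
          C∩U∩S≢∅
          (ℕ.<-≤-trans ∁C∩U∩S≢∅ (p⊆q⇒∣p∣≤∣q∣ (∩-monoˡ-⊆ S (∁∩⊆∁∩ C U))))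

    c≤induced : 0 ℕ.< ∣ (C ∩ U) ∩ T ∣ → 0 ℕ.< ∣ (∁ C ∩ U) ∩ T ∣ → c ≤ inducedCutWeight (w G) U C
    c≤induced C∩U∩T≢∅ ∁C∩U∩T≢∅ = by-cases (∣ (∁ C ∩ U) ∩ S ∣ ℕ.≟ 0) (∣ (C ∩ U) ∩ S ∣ ℕ.≟ 0)
      where
      by-cases : Dec (∣ (∁ C ∩ U) ∩ S ∣ ≡ 0) → Dec (∣ (C ∩ U) ∩ S ∣ ≡ 0) → c ≤ inducedCutWeight (w G) U C
      by-cases (yes ∁C∩U∩S≡∅) _ =
        no-sources⇒c≤ S⊆T 0≤c (Partition-swap (∩-∁-partition C U)) ∁C∩U∩S≡∅ ∁C∩U∩T≢∅
      by-cases (no _) (yes C∩U∩S≡∅) = subst (c ≤_) (between-comm G (∁ C ∩ U) (C ∩ U))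
        (no-sources⇒c≤ S⊆T 0≤c (∩-∁-partition C U) C∩U∩S≡∅ C∩U∩T≢∅)
      by-cases (no ∁C∩U∩S≢∅) (no C∩U∩S≢∅) =
        sources-on-both-sides⇒c≤ (ℕ.n≢0⇒n>0 C∩U∩S≢∅) (ℕ.n≢0⇒n>0 ∁C∩U∩S≢∅)

    strongAt : StrongAt G bound δ κ (U ∩ T) U C
    strongAt =
      ≤-trans (ℕ→ℚ-mono-≤ (ℕ.m⊓n≤m ∣ C ∩ U ∩ (U ∩ T) ∣ ∣ ∁ C ∩ U ∩ (U ∩ T) ∣))
              (subst (λ X → ℕ→ℚ ∣ X ∣ ≤ bound) (sym (∩-∩-absorb C U T)) ∣C∩U∩T∣≤) ,
      λ C∩U∩T≢∅ ∁C∩U∩T≢∅ → subst (_≤ inducedCutWeight (w G) U C) (*-comm δ κ)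
        (c≤induced (subst (λ X → 0 ℕ.< ∣ X ∣) (∩-∩-absorb C U T) C∩U∩T≢∅)
                   (subst (λ X → 0 ℕ.< ∣ X ∣) (∩-∩-absorb (∁ C) U T) ∁C∩U∩T≢∅))

  U-strong : TerminalStrong G T bound δ κ (U ∩ T) U
  U-strong C st hC = [ (λ C-fewer → strongAt C hC (sources≤s (ℕ.m≤n⇒m⊓n≡m C-fewer)))
                     , (λ ∁C-fewer → StrongAt-∁ G {bound} {δ} {κ} {U ∩ T} {U} C
                         (strongAt (∁ C) (subst (_≤ δ) (sym (cutWeight-∁ G C)) hC)
                                   (sources≤s (ℕ.m≥n⇒m⊓n≡n ∁C-fewer))))
                     ]′ (ℕ.≤-total ∣ C ∩ S ∣ ∣ ∁ C ∩ S ∣)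
    where
    sources≤s : ∀ {m} → ∣ C ∩ S ∣ ℕ.⊓ ∣ ∁ C ∩ S ∣ ≡ m → ℕ→ℚ m ≤ s
    sources≤s eq = subst (λ m → ℕ→ℚ m ≤ s) eq (fewer-sources≤s C st hC)

theorem4p9 : ∀ {n} (G : WGraph n) (T S : Subset n) (s δ γ : ℚ) →
    S ⊆ T → 2 ℕ.* ∣ T ∣ ℕ.≤ 3 ℕ.* ∣ S ∣ →
    (hs : 0ℚ < s) → 0ℚ < δ → (hγ : 0ℚ < γ) →
    TerminalStrong G T s δ γ S ⊤ →
    (U' : Subset (suc (suc n))) →
    IsMinSTCut (augW (w G) T S (δ * kappa s γ hs)) U' →
    (∣ T ∣ ℕ.≤ 3 ℕ.* ∣ tail (tail U') ∩ T ∣)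
    × TerminalStrong G T ((twoOverKappa s γ hs hγ + s) ⊔ (ℕ→ℚ 3 * s)) δ (kappa s γ hs)
        (tail (tail U') ∩ T) (tail (tail U'))
theorem4p9 G T S s δ γ S⊆T 2∣T∣≤3∣S∣ hs hδ hγ strong (inside ∷ outside ∷ U) U′-min@((refl , refl) , _) =
  ∣T∣≤3∣U∩T∣ S⊆T 2∣T∣≤3∣S∣ (positive⁻¹ c {{c-pos}}) , U-strong
  where
  open MinCutSourceSide G T S s δ γ S⊆T hs hδ hγ strong U
    (isMinSTCut⇒minimal (w G) T S (δ * kappa s γ hs) U U′-min)
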